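{- Let $\lambda\in\mathbb{C}$ with $\lambda\neq 1$, let $r,k\in\mathbb{Z}$ and $n\in\mathbb{Z}_{\geq 0}$. Then \[ T_{n}^{(r,k)}(x|\lambda)=\sum_{l=0}^{n}\left\{\sum_{j=l}^{n}\sum_{m=0}^{n-j}(-1)^{n-m-j}\binom{n}{j}\binom{j}{l}\frac{m!}{(m+1)^k}H_{j-l}^{(r)}(\lambda)S_{2}(n-j, m)\right\} x^{l}. \]
   Context: For $k\in\mathbb{Z}$, $Li_k(x)=\sum_{n\ge1}x^n/n^k$. The polynomials $T_n^{(r,k)}(x|\lambda)$ are defined by $\left(\frac{1-\lambda}{e^t-\lambda}\right)^r\frac{Li_{k}(1-e^{ -t})}{1-e^{ -t}}e^{xt}=\sum_{n\ge0}T_n^{(r,k)}(x|\lambda)\frac{t^n}{n!}$ (as formal power series in $t$). The Frobenius-Euler numbers of order $r$ are defined by $\left(\frac{1-\lambda}{e^t-\lambda}\right)^{r}=\sum_{n\ge0}H_n^{(r)}(\lambda)\frac{t^n}{n!}$. $S_2(l,m)$ denotes the Stirling numbers of the second kind, $(e^t-1)^m=m!\sum_{l\ge m}S_2(l,m)\frac{t^l}{l!}$. -}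

module Defs where

open import Level using (Level)
open import Algebra.Bundles using (CommutativeRing)
open import Data.Nat as ℕ using (ℕ; zero; suc; _∸_; _!)
open import Data.Integer as ℤ using (ℤ; +_; -[1+_])
open import Data.List using (List; []; _∷_; zipWith; map; upTo)
open import Data.Nat.Combinatorics using (_C_)

S₂ : ℕ → ℕ → ℕ
S₂ zero    zero    = 1
S₂ zero    (suc m) = 0
S₂ (suc l) zero    = 0
S₂ (suc l) (suc m) = suc m ℕ.* S₂ l (suc m) ℕ.+ S₂ l m

module _ {c ℓ : Level} (R : CommutativeRing c ℓ) where
  open CommutativeRing R renaming (Carrier to K)

  Σ< : ℕ → (ℕ → K) → K
  Σ< zero    f = 0#
  Σ< (suc N) f = Σ< N f + f N

  -- Σ_{i=a}^{b} f i  (empty if b < a)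
  ΣFT : ℕ → ℕ → (ℕ → K) → K
  ΣFT a b f = Σ< (suc b ∸ a) (λ i → f (a ℕ.+ i))

  sumL : List K → K
  sumL []       = 0#
  sumL (x ∷ xs) = x + sumL xs

  fromℕ : ℕ → K
  fromℕ zero    = 0#
  fromℕ (suc n) = 1# + fromℕ n

  pow : K → ℕ → K
  pow x zero    = 1#
  pow x (suc n) = pow x n * x

  sgn : ℕ → K
  sgn n = pow (- 1#) n

  -- Formal power series in t: coefficient sequences (f n = [t^n] f)
  PS : Set c
  PS = ℕ → K

  constPS : K → PS
  constPS a zero    = a
  constPS a (suc n) = 0#

  _⊕_ : PS → PS → PS
  (f ⊕ g) n = f n + g n

  _⊖_ : PS → PS → PS
  (f ⊖ g) n = f n + - g n

  _⊛_ : PS → PS → PS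
  (f ⊛ g) n = ΣFT 0 n (λ i → f i * g (n ∸ i))

  psPow : PS → ℕ → PS
  psPow f zero    = constPS 1#
  psPow f (suc m) = psPow f m ⊛ f

  -- Multiplicative inverse of a series f, given an inverse a of its
  -- constant term f 0:  g 0 = a,  g n = - a * Σ_{i=1}^{n} f i * g (n - i).
  -- invRev f a n = [g n, g (n-1), ..., g 0].
  invRev : PS → K → ℕ → List K
  invRev f a zero    = a ∷ []
  invRev f a (suc n) =
    (- (a * sumL (zipWith _*_ (map (λ i → f (suc i)) (upTo (suc n))) (invRev f a n))))
      ∷ invRev f a n

  headOr0 : List K → K
  headOr0 []      = 0#
  headOr0 (x ∷ _) = x

  psInv : PS → K → PS
  psInv f a n = headOr0 (invRev f a n)

  -- integer power of a series f whose constant term has inverse a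
  zpowPS : PS → K → ℤ → PS
  zpowPS f a (+ p)      = psPow f p
  zpowPS f a -[1+ p ]   = psPow (psInv f a) (suc p)

  -- composition L(g(t)) for a series g with zero constant term
  compose : PS → PS → PS
  compose L g n = ΣFT 0 n (λ m → L m * psPow g m n)

  shift : PS → PS
  shift f n = f (suc n)

  -- quotient f/g for f, g with zero constant terms, a = inverse of g 1
  quot : PS → PS → K → PS
  quot f g a = shift f ⊛ psInv (shift g) a

  -- ι n is (a chosen) inverse of n+1 in K
  module _ (ι : ℕ → K) where

    invFact : ℕ → K
    invFact zero    = 1#
    invFact (suc n) = invFact n * ι n

    expPS : K → PS
    expPS x n = pow x n * invFact n

    invPowZ : ℕ → ℤ → K
    invPowZ m (+ p)    = pow (ι m) p
    invPowZ m -[1+ p ] = pow (fromℕ (suc m)) (suc p)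

    -- Li_k(y) = Σ_{n≥1} y^n / n^k as a series in y
    LiPS : ℤ → PS
    LiPS k zero    = 0#
    LiPS k (suc m) = invPowZ m k

    oneMinusExpNeg : PS
    oneMinusExpNeg = constPS 1# ⊖ expPS (- 1#)

    -- Li_k(1-e^{-t}) / (1-e^{-t})   ([t^1](1-e^{-t}) = 1)
    LiQuot : ℤ → PS
    LiQuot k = quot (compose (LiPS k) oneMinusExpNeg) oneMinusExpNeg 1#

    -- lam = λ, μ = inverse of (1 - λ)
    module _ (lam μ : K) where

      FE : PS
      FE = constPS (1# + - lam) ⊛ psInv (expPS 1# ⊖ constPS lam) μ

      -- ((1-λ)/(e^t-λ))^r   (constant term of FE is 1)
      FEpow : ℤ → PS
      FEpow r = zpowPS FE 1# r

      H : ℕ → ℤ → K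
      H n r = fromℕ (n !) * FEpow r n

      T : ℤ → ℤ → ℕ → K → K
      T r k n x = fromℕ (n !) * ((FEpow r ⊛ LiQuot k) ⊛ expPS x) n

{-# OPTIONS --safe #-}
-- In exponential-generating-function coefficients n! [tⁿ] the Cauchy product becomes the binomial
-- convolution, so T is the binomial convolution of e^{xt}, of the Frobenius–Euler factor and of
-- Li_k(1-e^{-t})/(1-e^{-t}).  Writing g = 1-e^{-t}, the last factor is Σ_m g^m/(m+1)^k, and
-- n! [tⁿ] g^m = m! (-1)^{n-m} S₂(n,m) follows by induction on n from g′ = 1 - g, i.e.
-- (g^{m+1})′ = (m+1)(g^m - g^{m+1}), which is the Stirling recurrence.  Expanding the two binomial
-- convolutions and collecting the coefficient of x^l gives the formula.  The Frobenius–Euler factor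
-- enters only through its coefficients H, so the invertibility of 1 - λ is never used.
module Submission where

open import Defs hiding (_⊛_; _⊕_; _⊖_)
import Defs
open import Level using (Level)
open import Algebra.Bundles using (CommutativeRing)
open import Data.Nat using (ℕ; suc; _∸_; _!)
open import Data.Integer using (ℤ)
open import Data.Nat.Combinatorics using (_C_)

import Data.Nat as ℕ
open import Data.Nat using (zero; z≤n; s≤s)
import Data.Nat.Properties as ℕₚ
open import Data.Nat.Combinatorics using (nCk≡n!/k![n-k]!; k![n∸k]!∣n!)
open import Data.Nat.DivMod using (m*[n/m]≡n)
open import Data.List using (zipWith; map; upTo; applyUpTo)
import Data.List.Properties as List
open import Data.Sum using (inj₁; inj₂)
open import Function using (_∘_)
open import Relation.Binary.Bundles using (Setoid)
open import Relation.Binary.PropositionalEquality as ≡ using (_≡_)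
open import Relation.Nullary using (yes; no)

n!≡nCk*[k!*[n∸k]!] : ∀ {n k} → k ℕ.≤ n → n ! ≡ (n C k) ℕ.* (k ! ℕ.* (n ∸ k) !)
n!≡nCk*[k!*[n∸k]!] {n} {k} k≤n = ≡.trans (≡.sym (m*[n/m]≡n (k![n∸k]!∣n! k≤n)))
  (≡.trans (ℕₚ.*-comm (k ! ℕ.* (n ∸ k) !) _)
           (≡.cong (ℕ._* (k ! ℕ.* (n ∸ k) !)) (≡.sym (nCk≡n!/k![n-k]! k≤n))))
  where instance _ = ℕₚ._!*_!≢0 k (n ∸ k)

i<j⇒S₂[i,j]≡0 : ∀ {i j} → i ℕ.< j → S₂ i j ≡ 0
i<j⇒S₂[i,j]≡0 {zero}  {suc j} _ = ≡.refl
i<j⇒S₂[i,j]≡0 {suc i} {suc j} (s≤s i<j)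
  rewrite i<j⇒S₂[i,j]≡0 (ℕₚ.m<n⇒m<1+n i<j) | i<j⇒S₂[i,j]≡0 i<j | ℕₚ.*-zeroʳ j = ≡.refl

m∸n∸o≡m∸o∸n : ∀ m n o → m ∸ n ∸ o ≡ m ∸ o ∸ n
m∸n∸o≡m∸o∸n m n o = ≡.trans (ℕₚ.∸-+-assoc m n o)
  (≡.trans (≡.cong (m ∸_) (ℕₚ.+-comm n o)) (≡.sym (ℕₚ.∸-+-assoc m o n)))

module Sums {c ℓ : Level} (R : CommutativeRing c ℓ) where
  open CommutativeRing R renaming (Carrier to K)
  open import Relation.Binary.Reasoning.Setoid setoid
  open import Algebra.Properties.AbelianGroup +-abelianGroup using (⁻¹-∙-comm)
  open import Algebra.Properties.Group +-group using (ε⁻¹≈ε)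
  open import Algebra.Properties.CommutativeSemigroup +-commutativeSemigroup using (interchange)

  Σ<-cong-< : ∀ N {f g : ℕ → K} → (∀ i → i ℕ.< N → f i ≈ g i) → Σ< R N f ≈ Σ< R N g
  Σ<-cong-< zero    f≈g = refl
  Σ<-cong-< (suc N) f≈g =
    +-cong (Σ<-cong-< N (λ i i<N → f≈g i (ℕₚ.m<n⇒m<1+n i<N))) (f≈g N (ℕₚ.n<1+n N))

  Σ<-cong : ∀ N {f g : ℕ → K} → (∀ i → f i ≈ g i) → Σ< R N f ≈ Σ< R N g
  Σ<-cong N f≈g = Σ<-cong-< N (λ i _ → f≈g i)

  Σ<-length : ∀ {N M} (f : ℕ → K) → N ≡ M → Σ< R N f ≈ Σ< R M f
  Σ<-length f ≡.refl = refl

  Σ<-zero : ∀ N {f : ℕ → K} → (∀ i → i ℕ.< N → f i ≈ 0#) → Σ< R N f ≈ 0#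
  Σ<-zero zero    f≈0 = refl
  Σ<-zero (suc N) f≈0 = trans
    (+-cong (Σ<-zero N (λ i i<N → f≈0 i (ℕₚ.m<n⇒m<1+n i<N))) (f≈0 N (ℕₚ.n<1+n N)))
    (+-identityʳ 0#)

  Σ<-distrib-+ : ∀ N (f g : ℕ → K) → Σ< R N (λ i → f i + g i) ≈ Σ< R N f + Σ< R N g
  Σ<-distrib-+ zero    f g = sym (+-identityˡ 0#)
  Σ<-distrib-+ (suc N) f g = trans (+-congʳ (Σ<-distrib-+ N f g)) (interchange _ _ _ _)

  *-distribˡ-Σ< : ∀ N a (f : ℕ → K) → a * Σ< R N f ≈ Σ< R N (λ i → a * f i)
  *-distribˡ-Σ< zero    a f = zeroʳ a
  *-distribˡ-Σ< (suc N) a f = trans (distribˡ a _ _) (+-congʳ (*-distribˡ-Σ< N a f))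

  *-distribʳ-Σ< : ∀ N a (f : ℕ → K) → Σ< R N f * a ≈ Σ< R N (λ i → f i * a)
  *-distribʳ-Σ< zero    a f = zeroˡ a
  *-distribʳ-Σ< (suc N) a f = trans (distribʳ a _ _) (+-congʳ (*-distribʳ-Σ< N a f))

  -‿distrib-Σ< : ∀ N (f : ℕ → K) → - Σ< R N f ≈ Σ< R N (λ i → - f i)
  -‿distrib-Σ< zero    f = ε⁻¹≈ε
  -‿distrib-Σ< (suc N) f = trans (sym (⁻¹-∙-comm _ _)) (+-congʳ (-‿distrib-Σ< N f))

  *-distrib-Σ<×Σ< : ∀ N M a (f g : ℕ → K) →
                    a * (Σ< R N f * Σ< R M g) ≈ Σ< R N (λ i → Σ< R M (λ j → a * (f i * g j)))
  *-distrib-Σ<×Σ< N M a f g = begin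
      a * (Σ< R N f * Σ< R M g)
    ≈⟨ *-congˡ (*-distribʳ-Σ< N _ f) ⟩
      a * Σ< R N (λ i → f i * Σ< R M g)
    ≈⟨ *-distribˡ-Σ< N a _ ⟩
      Σ< R N (λ i → a * (f i * Σ< R M g))
    ≈⟨ Σ<-cong N (λ i → trans (*-congˡ (*-distribˡ-Σ< M (f i) g)) (*-distribˡ-Σ< M a _)) ⟩
      Σ< R N (λ i → Σ< R M (λ j → a * (f i * g j)))
    ∎

  Σ<-head : ∀ N (f : ℕ → K) → Σ< R (suc N) f ≈ f 0 + Σ< R N (f ∘ suc)
  Σ<-head zero    f = trans (+-identityˡ _) (sym (+-identityʳ _))
  Σ<-head (suc N) f = trans (+-congʳ (Σ<-head N f)) (+-assoc _ _ _)

  Σ<-comm : ∀ N M (F : ℕ → ℕ → K) →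
            Σ< R N (λ i → Σ< R M (F i)) ≈ Σ< R M (λ j → Σ< R N (λ i → F i j))
  Σ<-comm zero    M F = sym (Σ<-zero M (λ _ _ → refl))
  Σ<-comm (suc N) M F = trans (+-congʳ (Σ<-comm N M F)) (sym (Σ<-distrib-+ M _ _))

  Σ<-reverse : ∀ N (f : ℕ → K) → Σ< R (suc N) f ≈ Σ< R (suc N) (λ i → f (N ∸ i))
  Σ<-reverse zero    f = refl
  Σ<-reverse (suc N) f = trans (+-congʳ (Σ<-reverse N f))
    (trans (+-comm _ _) (sym (Σ<-head (suc N) (λ i → f (suc N ∸ i)))))

  Σ<-drop-zeros : ∀ {a b} (f : ℕ → K) → a ℕ.≤ b →
                  (∀ i → a ℕ.≤ i → i ℕ.< b → f i ≈ 0#) → Σ< R b f ≈ Σ< R a f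
  Σ<-drop-zeros {b = zero} f z≤n f≈0 = refl
  Σ<-drop-zeros {b = suc b} f a≤1+b f≈0 with ℕₚ.m≤n⇒m<n∨m≡n a≤1+b
  ... | inj₂ ≡.refl    = refl
  ... | inj₁ (s≤s a≤b) = trans
    (+-cong (Σ<-drop-zeros f a≤b (λ i a≤i i<b → f≈0 i a≤i (ℕₚ.m<n⇒m<1+n i<b)))
            (f≈0 b a≤b (ℕₚ.n<1+n b)))
    (+-identityʳ _)

  ΣFT-snoc : ∀ l n (f : ℕ → K) → l ℕ.≤ suc n → ΣFT R l (suc n) f ≈ ΣFT R l n f + f (suc n)
  ΣFT-snoc l n f l≤1+n = trans (Σ<-length (λ i → f (l ℕ.+ i)) (ℕₚ.+-∸-assoc 1 l≤1+n))
    (+-congˡ (reflexive (≡.cong f (ℕₚ.m+[n∸m]≡n l≤1+n))))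

  ΣFT-single : ∀ n (f : ℕ → K) → ΣFT R n n f ≈ f n
  ΣFT-single n f = trans (Σ<-length (λ i → f (n ℕ.+ i)) (ℕₚ.m+n∸n≡m 1 n))
    (trans (+-identityˡ _) (reflexive (≡.cong f (ℕₚ.+-identityʳ n))))

  Σ<-triangle : ∀ n (F : ℕ → ℕ → K) →
                Σ< R (suc n) (λ j → Σ< R (suc j) (λ l → F l j))
                ≈ Σ< R (suc n) (λ l → ΣFT R l n (F l))
  Σ<-triangle zero    F = refl
  Σ<-triangle (suc n) F = begin
      Σ< R (suc n) (λ j → Σ< R (suc j) (λ l → F l j)) + Σ< R (suc (suc n)) (λ l → F l (suc n))
    ≈⟨ +-congʳ (Σ<-triangle n F) ⟩
      Σ< R (suc n) (λ l → ΣFT R l n (F l)) + (Σ< R (suc n) (λ l → F l (suc n)) + F (suc n) (suc n))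
    ≈⟨ +-assoc _ _ _ ⟨
      (Σ< R (suc n) (λ l → ΣFT R l n (F l)) + Σ< R (suc n) (λ l → F l (suc n))) + F (suc n) (suc n)
    ≈⟨ +-cong (Σ<-distrib-+ (suc n) _ _) (ΣFT-single (suc n) (F (suc n))) ⟨
      Σ< R (suc n) (λ l → ΣFT R l n (F l) + F l (suc n)) + ΣFT R (suc n) (suc n) (F (suc n))
    ≈⟨ +-congʳ (Σ<-cong-< (suc n) (λ l l<1+n → ΣFT-snoc l n (F l) (ℕₚ.<⇒≤ l<1+n))) ⟨
      Σ< R (suc n) (λ l → ΣFT R l (suc n) (F l)) + ΣFT R (suc n) (suc n) (F (suc n))
    ∎

module PowerSeries {c ℓ : Level} (R : CommutativeRing c ℓ) where
  open CommutativeRing R renaming (Carrier to K)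
  open import Relation.Binary.Reasoning.Setoid setoid
  open import Algebra.Properties.Ring ring
    using (-‿distribˡ-*; -‿distribʳ-*; -‿involutive; -1*x≈-x)
  open import Algebra.Properties.AbelianGroup +-abelianGroup using (⁻¹-anti-homo‿-; xyx⁻¹≈y)
  open import Algebra.Properties.Group +-group using (ε⁻¹≈ε)
  open import Algebra.Properties.CommutativeSemigroup *-commutativeSemigroup
    using (x∙yz≈y∙xz; xy∙z≈y∙xz) renaming (interchange to *-interchange)
  open import Algebra.Properties.Semiring.Mult semiring using (_×_; ×-homo-+; ×1-homo-*)
  open import Function.Indexed.Relation.Binary.Equality using (≡-setoid)
  import Relation.Binary.Indexed.Heterogeneous.Construct.Trivial as Trivial
  open import Algebra.Solver.CommutativeMonoid *-commutativeMonoid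
    using (solve; _⊜_) renaming (_⊕_ to _⊗_)
  open Sums R

  infixl 7 _⊛_
  infixl 6 _⊕_ _⊖_
  infix 4 _≋_

  _⊛_ _⊕_ _⊖_ : PS R → PS R → PS R
  _⊛_ = Defs._⊛_ R
  _⊕_ = Defs._⊕_ R
  _⊖_ = Defs._⊖_ R

  one : PS R
  one = constPS R 1#

  PS-setoid : Setoid c ℓ
  PS-setoid = ≡-setoid ℕ (Trivial.indexedSetoid setoid)

  _≋_ : PS R → PS R → Set ℓ
  _≋_ = Setoid._≈_ PS-setoid

  module ≋ = Setoid PS-setoid

  ⊛-cong : ∀ {f f′ g g′} → f ≋ f′ → g ≋ g′ → f ⊛ g ≋ f′ ⊛ g′
  ⊛-cong f≋f′ g≋g′ n = Σ<-cong (suc n) (λ i → *-cong (f≋f′ i) (g≋g′ (n ∸ i)))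

  ⊛-comm : ∀ f g → f ⊛ g ≋ g ⊛ f
  ⊛-comm f g n = trans (Σ<-reverse n _) (Σ<-cong-< (suc n) (λ i i≤n →
    trans (*-congˡ (reflexive (≡.cong g (ℕₚ.m∸[m∸n]≡n (ℕₚ.≤-pred i≤n))))) (*-comm _ _)))

  ⊛-identityˡ : ∀ f → one ⊛ f ≋ f
  ⊛-identityˡ f n = trans (Σ<-head n _)
    (trans (+-cong (*-identityˡ _) (Σ<-zero n (λ i _ → zeroˡ _))) (+-identityʳ _))

  ⊛-identityʳ : ∀ f → f ⊛ one ≋ f
  ⊛-identityʳ f = ≋.trans (⊛-comm f one) (⊛-identityˡ f)

  ⊛-assoc : ∀ f g h → (f ⊛ g) ⊛ h ≋ f ⊛ (g ⊛ h)
  ⊛-assoc f g h n = begin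
      Σ< R (suc n) (λ i → Σ< R (suc i) (λ j → f j * g (i ∸ j)) * h (n ∸ i))
    ≈⟨ Σ<-cong (suc n) (λ i → *-distribʳ-Σ< (suc i) _ _) ⟩
      Σ< R (suc n) (λ i → Σ< R (suc i) (λ j → (f j * g (i ∸ j)) * h (n ∸ i)))
    ≈⟨ Σ<-triangle n (λ j i → (f j * g (i ∸ j)) * h (n ∸ i)) ⟩
      Σ< R (suc n) (λ j → ΣFT R j n (λ i → (f j * g (i ∸ j)) * h (n ∸ i)))
    ≈⟨ Σ<-cong-< (suc n) (λ j j≤n → trans (Σ<-length _ (ℕₚ.+-∸-assoc 1 (ℕₚ.≤-pred j≤n)))
         (Σ<-cong (suc (n ∸ j)) (λ i → trans
           (*-cong (*-congˡ (reflexive (≡.cong g (ℕₚ.m+n∸m≡n j i))))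
                   (reflexive (≡.cong h (≡.sym (ℕₚ.∸-+-assoc n j i)))))
           (*-assoc _ _ _)))) ⟩
      Σ< R (suc n) (λ j → Σ< R (suc (n ∸ j)) (λ i → f j * (g i * h (n ∸ j ∸ i))))
    ≈⟨ Σ<-cong (suc n) (λ j → *-distribˡ-Σ< (suc (n ∸ j)) _ _) ⟨
      Σ< R (suc n) (λ j → f j * Σ< R (suc (n ∸ j)) (λ i → g i * h (n ∸ j ∸ i)))
    ∎

  ⊛-distribˡ-⊖ : ∀ f g h → f ⊛ (g ⊖ h) ≋ f ⊛ g ⊖ f ⊛ h
  ⊛-distribˡ-⊖ f g h n = trans
    (Σ<-cong (suc n) (λ i → trans (distribˡ _ _ _) (+-congˡ (sym (-‿distribʳ-* _ _)))))
    (trans (Σ<-distrib-+ (suc n) _ _) (+-congˡ (sym (-‿distrib-Σ< (suc n) _))))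

  ⊛-scaleˡ : ∀ a f g → (λ i → a * f i) ⊛ g ≋ (λ n → a * (f ⊛ g) n)
  ⊛-scaleˡ a f g n =
    trans (Σ<-cong (suc n) (λ i → *-assoc _ _ _)) (sym (*-distribˡ-Σ< (suc n) _ _))

  psInv-inverseʳ : ∀ f a → a * f 0 ≈ 1# → f ⊛ psInv R f a ≋ one
  psInv-inverseʳ f a a*f₀≈1 zero = trans (+-identityˡ _) (trans (*-comm _ _) a*f₀≈1)
  psInv-inverseʳ f a a*f₀≈1 (suc n) = begin
      Σ< R (suc (suc n)) (λ i → f i * f⁻¹ (suc n ∸ i))
    ≈⟨ Σ<-head (suc n) _ ⟩
      f 0 * - (a * tail) + rest
    ≈⟨ +-congʳ (trans (sym (-‿distribʳ-* _ _)) (-‿cong (trans (sym (*-assoc _ _ _))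
         (trans (*-cong (trans (*-comm _ _) a*f₀≈1) tail≈Σ) (*-identityˡ _))))) ⟩
      - rest + rest
    ≈⟨ -‿inverseˡ rest ⟩
      0#
    ∎
    where
      f⁻¹ : PS R
      f⁻¹ = psInv R f a
      tail rest : K
      tail = sumL R (zipWith _*_ (map (λ i → f (suc i)) (upTo (suc n))) (invRev R f a n))
      rest = Σ< R (suc n) (λ i → f (suc i) * f⁻¹ (n ∸ i))
      zipWith-invRev : ∀ (h : ℕ → K) n → sumL R (zipWith _*_ (applyUpTo h (suc n)) (invRev R f a n))
                                         ≈ Σ< R (suc n) (λ i → h i * f⁻¹ (n ∸ i))
      zipWith-invRev h zero    = trans (+-identityʳ _) (sym (+-identityˡ _))
      zipWith-invRev h (suc n) = trans (+-congˡ (zipWith-invRev (h ∘ suc) n)) (sym (Σ<-head (suc n) _))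
      tail≈Σ : tail ≈ rest
      tail≈Σ = trans
        (reflexive (≡.cong (λ xs → sumL R (zipWith _*_ xs (invRev R f a n)))
                           (List.map-applyUpTo (λ i → i) (λ i → f (suc i)) (suc n))))
        (zipWith-invRev (λ i → f (suc i)) n)

  fromℕ≡×1# : ∀ n → fromℕ R n ≡ n × 1#
  fromℕ≡×1# zero    = ≡.refl
  fromℕ≡×1# (suc n) = ≡.cong (1# +_) (fromℕ≡×1# n)

  fromℕ-homo-+ : ∀ m n → fromℕ R (m ℕ.+ n) ≈ fromℕ R m + fromℕ R n
  fromℕ-homo-+ m n
    rewrite fromℕ≡×1# (m ℕ.+ n) | fromℕ≡×1# m | fromℕ≡×1# n = ×-homo-+ 1# m n

  fromℕ-homo-* : ∀ m n → fromℕ R (m ℕ.* n) ≈ fromℕ R m * fromℕ R n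
  fromℕ-homo-* m n
    rewrite fromℕ≡×1# (m ℕ.* n) | fromℕ≡×1# m | fromℕ≡×1# n = ×1-homo-* m n

  D : PS R → PS R
  D f n = fromℕ R (suc n) * f (suc n)

  D-⊛ : ∀ f g → D (f ⊛ g) ≋ D f ⊛ g ⊕ f ⊛ D g
  D-⊛ f g n = begin
      fromℕ R (suc n) * Σ< R (suc (suc n)) (λ i → f i * g (suc n ∸ i))
    ≈⟨ *-distribˡ-Σ< (suc (suc n)) _ _ ⟩
      Σ< R (suc (suc n)) (λ i → fromℕ R (suc n) * (f i * g (suc n ∸ i)))
    ≈⟨ Σ<-cong-< (suc (suc n)) (λ i i≤1+n → trans
         (*-congʳ (trans (reflexive (≡.cong (fromℕ R) (≡.sym (ℕₚ.m+[n∸m]≡n (ℕₚ.≤-pred i≤1+n)))))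
                         (fromℕ-homo-+ i (suc n ∸ i))))
         (distribʳ _ _ _)) ⟩
      Σ< R (suc (suc n)) (λ i → fromℕ R i * (f i * g (suc n ∸ i))
                                + fromℕ R (suc n ∸ i) * (f i * g (suc n ∸ i)))
    ≈⟨ Σ<-distrib-+ (suc (suc n)) _ _ ⟩
      Σ< R (suc (suc n)) (λ i → fromℕ R i * (f i * g (suc n ∸ i)))
        + Σ< R (suc (suc n)) (λ i → fromℕ R (suc n ∸ i) * (f i * g (suc n ∸ i)))
    ≈⟨ +-cong left right ⟩
      (D f ⊛ g) n + (f ⊛ D g) n
    ∎
    where
      left : Σ< R (suc (suc n)) (λ i → fromℕ R i * (f i * g (suc n ∸ i))) ≈ (D f ⊛ g) n
      left = trans (Σ<-head (suc n) _) (trans (+-congʳ (zeroˡ _))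
        (trans (+-identityˡ _) (Σ<-cong (suc n) (λ i → sym (*-assoc _ _ _)))))
      right : Σ< R (suc (suc n)) (λ i → fromℕ R (suc n ∸ i) * (f i * g (suc n ∸ i))) ≈ (f ⊛ D g) n
      right = trans (+-congˡ (trans (*-congʳ (reflexive (≡.cong (fromℕ R) (ℕₚ.n∸n≡0 n)))) (zeroˡ _)))
        (trans (+-identityʳ _) (Σ<-cong-< (suc n) (λ i i≤n → trans
          (reflexive (≡.cong (λ j → fromℕ R j * (f i * g j)) (ℕₚ.+-∸-assoc 1 (ℕₚ.≤-pred i≤n))))
          (x∙yz≈y∙xz _ _ _))))

  D-psPow : ∀ g m n → D (psPow R g (suc m)) n ≈ fromℕ R (suc m) * (psPow R g m ⊛ D g) n
  D-psPow g zero n = begin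
      D (one ⊛ g) n
    ≈⟨ D-⊛ one g n ⟩
      (D one ⊛ g) n + (one ⊛ D g) n
    ≈⟨ +-congʳ (Σ<-zero (suc n) (λ i _ → trans (*-congʳ (zeroʳ _)) (zeroˡ _))) ⟩
      0# + (one ⊛ D g) n
    ≈⟨ trans (+-identityˡ _) (sym (*-identityˡ _)) ⟩
      1# * (one ⊛ D g) n
    ≈⟨ *-congʳ (+-identityʳ 1#) ⟨
      fromℕ R 1 * (one ⊛ D g) n
    ∎
  D-psPow g (suc m) n = begin
      D (gᵐ⁺¹ ⊛ g) n
    ≈⟨ D-⊛ gᵐ⁺¹ g n ⟩
      (D gᵐ⁺¹ ⊛ g) n + (gᵐ⁺¹ ⊛ D g) n
    ≈⟨ +-congʳ (⊛-cong {g = g} (D-psPow g m) ≋.refl n) ⟩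
      ((λ i → k * (gᵐ ⊛ D g) i) ⊛ g) n + (gᵐ⁺¹ ⊛ D g) n
    ≈⟨ +-cong (trans (⊛-scaleˡ k _ g n) (*-congˡ (reorder n))) (sym (*-identityˡ _)) ⟩
      k * (gᵐ⁺¹ ⊛ D g) n + 1# * (gᵐ⁺¹ ⊛ D g) n
    ≈⟨ trans (sym (distribʳ _ _ _)) (*-congʳ (+-comm _ _)) ⟩
      (1# + k) * (gᵐ⁺¹ ⊛ D g) n
    ∎
    where
      gᵐ gᵐ⁺¹ : PS R
      gᵐ = psPow R g m
      gᵐ⁺¹ = psPow R g (suc m)
      k : K
      k = fromℕ R (suc m)
      reorder : (gᵐ ⊛ D g) ⊛ g ≋ gᵐ⁺¹ ⊛ D g
      reorder = ≋.trans (⊛-assoc gᵐ (D g) g)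
        (≋.trans (⊛-cong ≋.refl (⊛-comm (D g) g)) (≋.sym (⊛-assoc gᵐ g (D g))))

  egf : PS R → PS R
  egf f n = fromℕ R (n !) * f n

  egf-⊛ : ∀ f g n →
          egf (f ⊛ g) n ≈ Σ< R (suc n) (λ j → fromℕ R (n C j) * (egf f j * egf g (n ∸ j)))
  egf-⊛ f g n = trans (*-distribˡ-Σ< (suc n) _ _) (Σ<-cong-< (suc n) (λ j j≤n → begin
      fromℕ R (n !) * (f j * g (n ∸ j))
    ≈⟨ *-congʳ (reflexive (≡.cong (fromℕ R) (n!≡nCk*[k!*[n∸k]!] (ℕₚ.≤-pred j≤n)))) ⟩
      fromℕ R ((n C j) ℕ.* (j ! ℕ.* (n ∸ j) !)) * (f j * g (n ∸ j))
    ≈⟨ *-congʳ (trans (fromℕ-homo-* (n C j) _) (*-congˡ (fromℕ-homo-* (j !) _))) ⟩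
      fromℕ R (n C j) * (fromℕ R (j !) * fromℕ R ((n ∸ j) !)) * (f j * g (n ∸ j))
    ≈⟨ trans (*-assoc _ _ _) (*-congˡ (*-interchange _ _ _ _)) ⟩
      fromℕ R (n C j) * (egf f j * egf g (n ∸ j))
    ∎))

  egf-suc : ∀ f n → egf f (suc n) ≈ egf (D f) n
  egf-suc f n = trans (*-congʳ (fromℕ-homo-* (suc n) (n !))) (xy∙z≈y∙xz _ _ _)

  shift-⊛ : ∀ f h → h 0 ≈ 0# → ∀ n → (f ⊛ h) (suc n) ≈ (f ⊛ shift R h) n
  shift-⊛ f h h₀≈0 n = trans
    (+-cong (Σ<-cong-< (suc n) (λ i i≤n →
              *-congˡ (reflexive (≡.cong h (ℕₚ.+-∸-assoc 1 (ℕₚ.≤-pred i≤n))))))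
            (trans (*-congˡ (trans (reflexive (≡.cong h (ℕₚ.n∸n≡0 n))) h₀≈0)) (zeroʳ _)))
    (+-identityʳ _)

  -- For n ≤ m truncated subtraction gives no sign change; there S₂ n (suc m) = 0 saves the identity.
  -sgn[n∸1+m]*S₂ : ∀ n m → - (sgn R (n ∸ suc m) * fromℕ R (S₂ n (suc m)))
                           ≈ sgn R (n ∸ m) * fromℕ R (S₂ n (suc m))
  -sgn[n∸1+m]*S₂ n m with suc m ℕ.≤? n
  ... | yes m<n = begin
      - (sgn R (n ∸ suc m) * fromℕ R (S₂ n (suc m)))
    ≈⟨ -1*x≈-x _ ⟨
      - 1# * (sgn R (n ∸ suc m) * fromℕ R (S₂ n (suc m)))
    ≈⟨ trans (x∙yz≈y∙xz _ _ _) (sym (*-assoc _ _ _)) ⟩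
      sgn R (n ∸ suc m) * - 1# * fromℕ R (S₂ n (suc m))
    ≈⟨ *-congʳ (reflexive (≡.cong (sgn R) (ℕₚ.+-∸-assoc 1 m<n))) ⟨
      sgn R (n ∸ m) * fromℕ R (S₂ n (suc m))
    ∎
  ... | no m≮n = trans (-‿cong S≈0) (trans ε⁻¹≈ε (sym S≈0))
    where
      S≈0 : ∀ {a} → a * fromℕ R (S₂ n (suc m)) ≈ 0#
      S≈0 = trans (*-congˡ (reflexive (≡.cong (fromℕ R) (i<j⇒S₂[i,j]≡0 (s≤s (ℕₚ.≮⇒≥ m≮n))))))
                  (zeroʳ _)

  module Exponential (ι : ℕ → K) (ι-inverse : ∀ n → fromℕ R (suc n) * ι n ≈ 1#) where

    n!*invFact≈1 : ∀ n → fromℕ R (n !) * invFact R ι n ≈ 1#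
    n!*invFact≈1 zero    = trans (*-identityʳ _) (+-identityʳ 1#)
    n!*invFact≈1 (suc n) = begin
        fromℕ R (suc n ℕ.* n !) * (invFact R ι n * ι n)
      ≈⟨ *-congʳ (trans (fromℕ-homo-* (suc n) (n !)) (*-comm _ _)) ⟩
        fromℕ R (n !) * fromℕ R (suc n) * (invFact R ι n * ι n)
      ≈⟨ *-interchange _ _ _ _ ⟩
        fromℕ R (n !) * invFact R ι n * (fromℕ R (suc n) * ι n)
      ≈⟨ *-cong (n!*invFact≈1 n) (ι-inverse n) ⟩
        1# * 1#
      ≈⟨ *-identityˡ 1# ⟩
        1#
      ∎

    egf-expPS : ∀ x n → egf (expPS R ι x) n ≈ pow R x n
    egf-expPS x n = trans (x∙yz≈y∙xz _ _ _) (trans (*-congˡ (n!*invFact≈1 n)) (*-identityʳ _))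

    1-e⁻ᵗ : PS R
    1-e⁻ᵗ = oneMinusExpNeg R ι

    1-e⁻ᵗ-0 : 1-e⁻ᵗ 0 ≈ 0#
    1-e⁻ᵗ-0 = trans (+-congˡ (-‿cong (*-identityˡ 1#))) (-‿inverseʳ 1#)

    1-e⁻ᵗ-1 : 1-e⁻ᵗ 1 ≈ 1#
    1-e⁻ᵗ-1 = begin
        0# + - ((1# * - 1#) * (1# * ι 0))
      ≈⟨ +-identityˡ _ ⟩
        - ((1# * - 1#) * (1# * ι 0))
      ≈⟨ -‿cong (*-cong (*-identityˡ _) (trans (*-identityˡ _) ι₀≈1)) ⟩
        - (- 1# * 1#)
      ≈⟨ -‿cong (-1*x≈-x 1#) ⟩
        - (- 1#)
      ≈⟨ -‿involutive 1# ⟩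
        1#
      ∎
      where
        ι₀≈1 : ι 0 ≈ 1#
        ι₀≈1 = trans (sym (*-identityˡ _)) (trans (*-congʳ (sym (+-identityʳ 1#))) (ι-inverse 0))

    D-1-e⁻ᵗ : D 1-e⁻ᵗ ≋ one ⊖ 1-e⁻ᵗ
    D-1-e⁻ᵗ n = begin
        fromℕ R (suc n) * (0# + - (sgn R n * - 1# * (invFact R ι n * ι n)))
      ≈⟨ *-congˡ (trans (+-identityˡ _) (-‿cong (*-congʳ (trans (*-comm _ _) (-1*x≈-x _))))) ⟩
        fromℕ R (suc n) * - (- sgn R n * (invFact R ι n * ι n))
      ≈⟨ *-congˡ (trans (-‿cong (sym (-‿distribˡ-* _ _))) (-‿involutive _)) ⟩
        fromℕ R (suc n) * (sgn R n * (invFact R ι n * ι n))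
      ≈⟨ *-congˡ (sym (*-assoc _ _ _)) ⟩
        fromℕ R (suc n) * (sgn R n * invFact R ι n * ι n)
      ≈⟨ trans (x∙yz≈y∙xz _ _ _) (trans (*-congˡ (ι-inverse n)) (*-identityʳ _)) ⟩
        sgn R n * invFact R ι n
      ≈⟨ xyx⁻¹≈y (one n) _ ⟨
        one n + sgn R n * invFact R ι n + - one n
      ≈⟨ trans (+-congˡ (⁻¹-anti-homo‿- (one n) _)) (sym (+-assoc _ _ _)) ⟨
        one n + - (one n + - (sgn R n * invFact R ι n))
      ∎

    pow-1-e⁻ᵗ-⊛-D : ∀ m → psPow R 1-e⁻ᵗ m ⊛ D 1-e⁻ᵗ ≋ psPow R 1-e⁻ᵗ m ⊖ psPow R 1-e⁻ᵗ (suc m)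
    pow-1-e⁻ᵗ-⊛-D m n = trans (⊛-cong ≋.refl D-1-e⁻ᵗ n)
      (trans (⊛-distribˡ-⊖ _ one 1-e⁻ᵗ n) (+-congʳ (⊛-identityʳ _ n)))

    egf-pow-1-e⁻ᵗ : ∀ n m →
                    egf (psPow R 1-e⁻ᵗ m) n ≈ fromℕ R (m !) * sgn R (n ∸ m) * fromℕ R (S₂ n m)
    egf-pow-1-e⁻ᵗ zero    zero    = sym (trans (*-congˡ (+-identityʳ 1#)) (*-identityʳ _))
    egf-pow-1-e⁻ᵗ zero    (suc m) = trans
      (*-congˡ (trans (+-identityˡ _) (trans (*-congˡ 1-e⁻ᵗ-0) (zeroʳ _))))
      (trans (zeroʳ _) (sym (zeroʳ _)))
    egf-pow-1-e⁻ᵗ (suc n) zero    = trans (zeroʳ _) (sym (zeroʳ _))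
    egf-pow-1-e⁻ᵗ (suc n) (suc m) = begin
        egf gᵐ⁺¹ (suc n)
      ≈⟨ egf-suc gᵐ⁺¹ n ⟩
        fromℕ R (n !) * D gᵐ⁺¹ n
      ≈⟨ *-congˡ (trans (D-psPow 1-e⁻ᵗ m n) (*-congˡ (pow-1-e⁻ᵗ-⊛-D m n))) ⟩
        fromℕ R (n !) * (k * (gᵐ n + - gᵐ⁺¹ n))
      ≈⟨ trans (x∙yz≈y∙xz _ _ _)
               (*-congˡ (trans (distribˡ _ _ _) (+-congˡ (sym (-‿distribʳ-* _ _))))) ⟩
        k * (egf gᵐ n + - egf gᵐ⁺¹ n)
      ≈⟨ *-congˡ (+-cong (egf-pow-1-e⁻ᵗ n m) (-‿cong (egf-pow-1-e⁻ᵗ n (suc m)))) ⟩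
        k * (M * σ * s₁ + - (fromℕ R (suc m ℕ.* m !) * sgn R (n ∸ suc m) * s₂))
      ≈⟨ *-congˡ (+-congˡ (trans (-‿cong (*-assoc _ _ _)) (trans (-‿distribʳ-* _ _)
           (*-cong (fromℕ-homo-* (suc m) (m !)) (-sgn[n∸1+m]*S₂ n m))))) ⟩
        k * (M * σ * s₁ + k * M * (σ * s₂))
      ≈⟨ regroup ⟩
        k * M * σ * (k * s₂ + s₁)
      ≈⟨ *-cong (*-congʳ (fromℕ-homo-* (suc m) (m !)))
                (trans (fromℕ-homo-+ (suc m ℕ.* S₂ n (suc m)) (S₂ n m))
                       (+-congʳ (fromℕ-homo-* (suc m) (S₂ n (suc m))))) ⟨
        fromℕ R (suc m ℕ.* m !) * σ * fromℕ R (S₂ (suc n) (suc m))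
      ∎
      where
        gᵐ gᵐ⁺¹ : PS R
        gᵐ = psPow R 1-e⁻ᵗ m
        gᵐ⁺¹ = psPow R 1-e⁻ᵗ (suc m)
        k M σ s₁ s₂ : K
        k = fromℕ R (suc m)
        M = fromℕ R (m !)
        σ = sgn R (n ∸ m)
        s₁ = fromℕ R (S₂ n m)
        s₂ = fromℕ R (S₂ n (suc m))
        regroup : k * (M * σ * s₁ + k * M * (σ * s₂)) ≈ k * M * σ * (k * s₂ + s₁)
        regroup = trans (distribˡ _ _ _) (trans (+-comm _ _)
          (trans (+-cong (solve 4 (λ k M σ s₂ → (k ⊗ ((k ⊗ M) ⊗ (σ ⊗ s₂)))
                                               ⊜ (((k ⊗ M) ⊗ σ) ⊗ (k ⊗ s₂))) refl k M σ s₂)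
                         (trans (sym (*-assoc _ _ _)) (*-congʳ (sym (*-assoc _ _ _)))))
                 (sym (distribˡ _ _ _))))

    pow-1-e⁻ᵗ-vanishes : ∀ {n m} → n ℕ.< m → psPow R 1-e⁻ᵗ m n ≈ 0#
    pow-1-e⁻ᵗ-vanishes {n} {m} n<m = begin
        psPow R 1-e⁻ᵗ m n
      ≈⟨ trans (*-congʳ (trans (*-comm _ _) (n!*invFact≈1 n))) (*-identityˡ _) ⟨
        invFact R ι n * fromℕ R (n !) * psPow R 1-e⁻ᵗ m n
      ≈⟨ trans (*-assoc _ _ _) (*-congˡ (egf-pow-1-e⁻ᵗ n m)) ⟩
        invFact R ι n * (fromℕ R (m !) * sgn R (n ∸ m) * fromℕ R (S₂ n m))
      ≈⟨ *-congˡ (trans (*-congˡ (reflexive (≡.cong (fromℕ R) (i<j⇒S₂[i,j]≡0 n<m)))) (zeroʳ _)) ⟩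
        invFact R ι n * 0#
      ≈⟨ zeroʳ _ ⟩
        0#
      ∎

    LiExpansion : ℤ → PS R
    LiExpansion k n = Σ< R (suc n) (λ m → invPowZ R ι m k * psPow R 1-e⁻ᵗ m n)

    shift-compose-LiPS : ∀ k →
                         shift R (compose R (LiPS R ι k) 1-e⁻ᵗ) ≋ LiExpansion k ⊛ shift R 1-e⁻ᵗ
    shift-compose-LiPS k n = begin
        Σ< R (suc (suc n)) (λ m → LiPS R ι k m * gᵐ m (suc n))
      ≈⟨ trans (Σ<-head (suc n) _) (trans (+-congʳ (zeroˡ _)) (+-identityˡ _)) ⟩
        Σ< R (suc n) (λ m → a m * (gᵐ m ⊛ 1-e⁻ᵗ) (suc n))
      ≈⟨ Σ<-cong (suc n) (λ m → trans (*-congˡ (shift-⊛ (gᵐ m) 1-e⁻ᵗ 1-e⁻ᵗ-0 n))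
                                      (*-distribˡ-Σ< (suc n) _ _)) ⟩
        Σ< R (suc n) (λ m → Σ< R (suc n) (λ j → a m * (gᵐ m j * g′ (n ∸ j))))
      ≈⟨ Σ<-comm (suc n) (suc n) _ ⟩
        Σ< R (suc n) (λ j → Σ< R (suc n) (λ m → a m * (gᵐ m j * g′ (n ∸ j))))
      ≈⟨ Σ<-cong (suc n) (λ j → trans (Σ<-cong (suc n) (λ m → sym (*-assoc _ _ _)))
                                      (sym (*-distribʳ-Σ< (suc n) _ _))) ⟩
        Σ< R (suc n) (λ j → Σ< R (suc n) (λ m → a m * gᵐ m j) * g′ (n ∸ j))
      ≈⟨ Σ<-cong-< (suc n) (λ j j<1+n → *-congʳ (Σ<-drop-zeros _ j<1+n (λ m j<m _ →
           trans (*-congˡ (pow-1-e⁻ᵗ-vanishes j<m)) (zeroʳ _)))) ⟩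
        (LiExpansion k ⊛ g′) n
      ∎
      where
        a : ℕ → K
        a m = invPowZ R ι m k
        gᵐ : ℕ → PS R
        gᵐ m = psPow R 1-e⁻ᵗ m
        g′ : PS R
        g′ = shift R 1-e⁻ᵗ

    LiQuot≋LiExpansion : ∀ k → LiQuot R ι k ≋ LiExpansion k
    LiQuot≋LiExpansion k = ≋.trans (⊛-cong {g = g′⁻¹} (shift-compose-LiPS k) ≋.refl)
      (≋.trans (⊛-assoc (LiExpansion k) g′ g′⁻¹)
      (≋.trans (⊛-cong ≋.refl (psInv-inverseʳ g′ 1# (trans (*-identityˡ _) 1-e⁻ᵗ-1)))
               (⊛-identityʳ (LiExpansion k))))
      where
        g′ g′⁻¹ : PS R
        g′ = shift R 1-e⁻ᵗ
        g′⁻¹ = psInv R g′ 1#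

    egf-LiQuot : ∀ k n →
                 egf (LiQuot R ι k) n
                 ≈ Σ< R (suc n) (λ m → sgn R (n ∸ m) * (fromℕ R (m !) * invPowZ R ι m k)
                                       * fromℕ R (S₂ n m))
    egf-LiQuot k n = trans (*-congˡ (LiQuot≋LiExpansion k n)) (trans (*-distribˡ-Σ< (suc n) _ _)
      (Σ<-cong (suc n) (λ m → trans (x∙yz≈y∙xz _ _ _) (trans (*-congˡ (egf-pow-1-e⁻ᵗ n m))
        (solve 4 (λ a M σ S → (a ⊗ ((M ⊗ σ) ⊗ S)) ⊜ ((σ ⊗ (M ⊗ a)) ⊗ S)) refl _ _ _ _)))))

theorem2 : ∀ {c ℓ : Level} (R : CommutativeRing c ℓ)
      → let open CommutativeRing R renaming (Carrier to K) in
        (ι : ℕ → K) → (∀ n → fromℕ R (suc n) * ι n ≈ 1#)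
      → (lam μ : K) → (1# + - lam) * μ ≈ 1#
      → (r k : ℤ) (n : ℕ) (x : K)
      → T R ι lam μ r k n x
        ≈ ΣFT R 0 n (λ l →
            ΣFT R l n (λ j → ΣFT R 0 (n ∸ j) (λ m →
              sgn R (n ∸ m ∸ j) * fromℕ R (n C j) * fromℕ R (j C l)
              * (fromℕ R (m !) * invPowZ R ι m k)
              * H R ι lam μ (j ∸ l) r * fromℕ R (S₂ (n ∸ j) m)))
            * pow R x l)
theorem2 R ι ι-inverse lam μ _ r k n x = begin
    egf ((F ⊛ L) ⊛ E) n
  ≈⟨ *-congˡ (≋.trans (⊛-comm (F ⊛ L) E) (≋.sym (⊛-assoc E F L)) n) ⟩
    egf ((E ⊛ F) ⊛ L) n
  ≈⟨ egf-⊛ (E ⊛ F) L n ⟩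
    Σ< R (suc n) (λ j → fromℕ R (n C j) * (egf (E ⊛ F) j * egf L (n ∸ j)))
  ≈⟨ Σ<-cong (suc n) (λ j → *-congˡ (*-cong
       (trans (egf-⊛ E F j) (Σ<-cong (suc j) (λ l → *-congˡ (*-congʳ (egf-expPS x l)))))
       (egf-LiQuot k (n ∸ j)))) ⟩
    Σ< R (suc n) (λ j → fromℕ R (n C j) * (Σ< R (suc j) (A j) * Σ< R (suc (n ∸ j)) (B j)))
  ≈⟨ Σ<-cong (suc n) (λ j → trans (*-distrib-Σ<×Σ< (suc j) (suc (n ∸ j)) _ _ _)
       (Σ<-cong (suc j) (λ l → trans (Σ<-cong (suc (n ∸ j)) (summand j l))
                                     (sym (*-distribʳ-Σ< (suc (n ∸ j)) _ _))))) ⟩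
    Σ< R (suc n) (λ j → Σ< R (suc j) (λ l → Σ< R (suc (n ∸ j)) (Y l j) * pow R x l))
  ≈⟨ Σ<-triangle n _ ⟩
    Σ< R (suc n) (λ l → ΣFT R l n (λ j → Σ< R (suc (n ∸ j)) (Y l j) * pow R x l))
  ≈⟨ Σ<-cong (suc n) (λ l → *-distribʳ-Σ< (suc n ∸ l) _ _) ⟨
    Σ< R (suc n) (λ l → ΣFT R l n (λ j → Σ< R (suc (n ∸ j)) (Y l j)) * pow R x l)
  ∎
  where
    open CommutativeRing R renaming (Carrier to K)
    open import Relation.Binary.Reasoning.Setoid setoid
    open import Algebra.Solver.CommutativeMonoid *-commutativeMonoid
      using (solve; _⊜_) renaming (_⊕_ to _⊗_)
    open Sums R
    open PowerSeries R
    open Exponential ι ι-inverse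
    F L E : PS R
    F = FEpow R ι lam μ r
    L = LiQuot R ι k
    E = expPS R ι x
    A B : ℕ → ℕ → K
    A j l = fromℕ R (j C l) * (pow R x l * H R ι lam μ (j ∸ l) r)
    B j m = sgn R (n ∸ j ∸ m) * (fromℕ R (m !) * invPowZ R ι m k) * fromℕ R (S₂ (n ∸ j) m)
    Y : ℕ → ℕ → ℕ → K
    Y l j m = sgn R (n ∸ m ∸ j) * fromℕ R (n C j) * fromℕ R (j C l)
      * (fromℕ R (m !) * invPowZ R ι m k) * H R ι lam μ (j ∸ l) r * fromℕ R (S₂ (n ∸ j) m)
    summand : ∀ j l m → fromℕ R (n C j) * (A j l * B j m) ≈ Y l j m * pow R x l
    summand j l m rewrite m∸n∸o≡m∸o∸n n j m =
      solve 7 (λ a b p h σ c s → (a ⊗ ((b ⊗ (p ⊗ h)) ⊗ ((σ ⊗ c) ⊗ s)))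
                               ⊜ ((((((σ ⊗ a) ⊗ b) ⊗ c) ⊗ h) ⊗ s) ⊗ p)) refl _ _ _ _ _ _ _
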